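{- Let $\varphi$ be a syntactically safe LTL formula, let $\mathcal{B}_{\mathbf{G}\varphi}$ and $\mathcal{R}=\mathit{relax}_{\mathbf{FG}}(\mathbf{G}\varphi)=(Q,q_0,\delta,F)$ with transition set $\mathit{Rej}(\mathcal{R})$ be as described in the context, let $\mathcal{T}=(S,s_0,\tau)$ be a transition system and let $G=(V,E)$ be the run graph of $\mathcal{R}$ on $\mathcal{T}$. Then $\mathcal{T}$ is accepted by $\mathcal{B}_{\mathbf{G}\varphi}$ if and only if for every edge $((s,q),\sigma,(s',q'))\in E$ with $(q,\sigma,q')\in\mathit{Rej}(\mathcal{R})$, the node $(s,q)$ is not reachable from $(s_0,q_0)$ in $G$.
   Context: $AP=I\cup O$ (disjoint inputs/outputs), $\Sigma=2^{AP}$. A transition system is $\mathcal{T}=(S,s_0,\tau)$ with $\tau:S\times 2^I\to S\times 2^O$. For an automaton $(Q,q_0,\delta,F)$ with $\delta\subseteq Q\times\Sigma\times Q$, its run graph on $\mathcal{T}$ has nodes $S\times Q$ and edges $((s,q),\sigma,(s',q'))$ iff $(q,\sigma,q')\in\delta$ and $\tau(s,\sigma\cap I)=(s',\sigma\cap O)$. A universal Büchi automaton accepts $\mathcal{T}$ iff every infinite path of its run graph from $(s_0,q_0)$ visits accepting states infinitely often. Construction of $\mathcal{B}_{\mathbf{G}\varphi}$: let $\mathcal{N}=(Q_N,q_0^N,\delta_N,F_N)$ be a nondeterministic finite automaton over $\Sigma$ such that every finite word accepted by $\mathcal{N}$ is a bad prefix of $\varphi$ (no infinite extension of it satisfies $\varphi$),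 and every infinite word violating $\varphi$ has a prefix accepted by $\mathcal{N}$. Let $\mathit{rej}\notin Q_N$ be new, $Q_\varphi=(Q_N\setminus F_N)\cup\{\mathit{rej}\}$, and $\delta_\varphi=(\delta_N\cap(Q_\varphi\times\Sigma\times Q_\varphi))\cup\{(q,\sigma,\mathit{rej})\mid\exists q'\in F_N:(q,\sigma,q')\in\delta_N\}\cup\{(\mathit{rej},\sigma,\mathit{rej})\mid\sigma\in\Sigma\}$. Then $\mathcal{B}_{\mathbf{G}\varphi}=(Q_\varphi,q_0^N,\delta_{\mathbf{G}\varphi},Q_\varphi\setminus\{\mathit{rej}\})$ is a universal Büchi automaton with $\delta_{\mathbf{G}\varphi}=\delta_\varphi\cup\{(q_0^N,\sigma,q_0^N)\mid\exists q'\neq\mathit{rej}:(q_0^N,\sigma,q')\in\delta_\varphi\}$. Construction of $\mathcal{R}=\mathit{relax}_{\mathbf{FG}}(\mathbf{G}\varphi)$: $Q=Q_\varphi\setminus\{\mathit{rej}\}$, $q_0=q_0^N$, $F=Q$, and $\delta=(\delta_{\mathbf{G}\varphi}\setminus\{(q,\sigma,q')\mid q'=\mathit{rej}\})\cup\{(q,\sigma,q_0)\mid(q,\sigma,\mathit{rej})\in\delta_{\mathbf{G}\varphi}\}$ (all transitions into $\mathit{rej}$ are redirected to the initial state). $\mathit{Rej}(\mathcal{R})=\{(q,\sigma,q_0)\in\delta\mid(q,\sigma,\mathit{rej})\in\delta_{\mathbf{G}\varphi}\}$. -}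

module Defs where

open import Data.Nat using (ℕ; zero; suc; _≤_; _<_)
open import Data.Fin using (Fin)
open import Data.Fin.Subset using (Subset)
open import Data.Vec using (lookup)
open import Data.Bool using (Bool; true; false; T)
open import Data.List using (List; []; _∷_; length)
open import Data.Product using (Σ; ∃; ∃-syntax; _×_; _,_; proj₁; proj₂)
open import Data.Sum using (_⊎_; inj₁; inj₂)
open import Data.Unit using (⊤)
open import Data.Empty using (⊥)
open import Relation.Nullary using (¬_)
open import Relation.Binary.PropositionalEquality using (_≡_; _≢_)
open import Relation.Binary.Construct.Closure.ReflexiveTransitive using (Star)

-- Atomic propositions AP = I ∪ O with I = Fin m, O = Fin n (disjoint),
-- letters σ ∈ Σ = 2^AP, represented as the pair (σ ∩ I , σ ∩ O).

AP : ℕ → ℕ → Set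
AP m n = Fin m ⊎ Fin n

Letter : ℕ → ℕ → Set
Letter m n = Subset m × Subset n

inputPart : ∀ {m n} → Letter m n → Subset m
inputPart = proj₁

outputPart : ∀ {m n} → Letter m n → Subset n
outputPart = proj₂

holds : ∀ {m n} → AP m n → Letter m n → Set
holds (inj₁ i) σ = T (lookup (proj₁ σ) i)
holds (inj₂ o) σ = T (lookup (proj₂ σ) o)

data LTL (A : Set) : Set where
  ltrue lfalse : LTL A
  atom : A → LTL A
  lnot : LTL A → LTL A
  _∧ₗ_ _∨ₗ_ : LTL A → LTL A → LTL A
  X : LTL A → LTL A
  _U_ _R_ _W_ : LTL A → LTL A → LTL A
  F G : LTL A → LTL A

Word : ℕ → ℕ → Set
Word m n = ℕ → Letter m n

Sat : ∀ {m n} → Word m n → ℕ → LTL (AP m n) → Set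
Sat w i ltrue = ⊤
Sat w i lfalse = ⊥
Sat w i (atom p) = holds p (w i)
Sat w i (lnot φ) = ¬ Sat w i φ
Sat w i (φ ∧ₗ ψ) = Sat w i φ × Sat w i ψ
Sat w i (φ ∨ₗ ψ) = Sat w i φ ⊎ Sat w i ψ
Sat w i (X φ) = Sat w (suc i) φ
Sat w i (φ U ψ) = ∃[ j ] (i ≤ j × Sat w j ψ × (∀ k → i ≤ k → k < j → Sat w k φ))
Sat w i (φ R ψ) = ∀ j → i ≤ j → Sat w j ψ ⊎ (∃[ k ] (i ≤ k × k < j × Sat w k φ))
Sat w i (φ W ψ) = (∃[ j ] (i ≤ j × Sat w j ψ × (∀ k → i ≤ k → k < j → Sat w k φ))) ⊎ (∀ j → i ≤ j → Sat w j φ)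
Sat w i (F φ) = ∃[ j ] (i ≤ j × Sat w j φ)
Sat w i (G φ) = ∀ j → i ≤ j → Sat w j φ

_⊨_ : ∀ {m n} → Word m n → LTL (AP m n) → Set
w ⊨ φ = Sat w 0 φ

data SyntacticallySafe {A : Set} : LTL A → Set where
  s-true  : SyntacticallySafe ltrue
  s-false : SyntacticallySafe lfalse
  s-atom  : ∀ p → SyntacticallySafe (atom p)
  s-natom : ∀ p → SyntacticallySafe (lnot (atom p))
  s-and   : ∀ {φ ψ} → SyntacticallySafe φ → SyntacticallySafe ψ → SyntacticallySafe (φ ∧ₗ ψ)
  s-or    : ∀ {φ ψ} → SyntacticallySafe φ → SyntacticallySafe ψ → SyntacticallySafe (φ ∨ₗ ψ)
  s-X     : ∀ {φ} → SyntacticallySafe φ → SyntacticallySafe (X φ)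
  s-R     : ∀ {φ ψ} → SyntacticallySafe φ → SyntacticallySafe ψ → SyntacticallySafe (φ R ψ)
  s-W     : ∀ {φ ψ} → SyntacticallySafe φ → SyntacticallySafe ψ → SyntacticallySafe (φ W ψ)
  s-G     : ∀ {φ} → SyntacticallySafe φ → SyntacticallySafe (G φ)

prefix : ∀ {m n} → Word m n → ℕ → List (Letter m n)
prefix w zero = []
prefix w (suc k) = w 0 ∷ prefix (λ i → w (suc i)) k

_++ω_ : ∀ {m n} → List (Letter m n) → Word m n → Word m n
([] ++ω w) i = w i
((a ∷ u) ++ω w) zero = a
((a ∷ u) ++ω w) (suc i) = (u ++ω w) i

record NFA (m n : ℕ) : Set₁ where
  field
    k    : ℕ
    init : Fin k
    trans : Fin k → Letter m n → Fin k → Set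
    final : Fin k → Set

data NRun {m n} (N : NFA m n) : Fin (NFA.k N) → List (Letter m n) → Fin (NFA.k N) → Set where
  done : ∀ {q} → NRun N q [] q
  step : ∀ {q σ q' u q''} → NFA.trans N q σ q' → NRun N q' u q'' → NRun N q (σ ∷ u) q''

NAccepts : ∀ {m n} → NFA m n → List (Letter m n) → Set
NAccepts N u = ∃[ q ] (NFA.final N q × NRun N (NFA.init N) u q)

AcceptsOnlyBadPrefixes : ∀ {m n} → NFA m n → LTL (AP m n) → Set
AcceptsOnlyBadPrefixes N φ =
  ∀ u → NAccepts N u → ∀ (w : Word _ _) → ¬ ((u ++ω w) ⊨ φ)

DetectsAllViolations : ∀ {m n} → NFA m n → LTL (AP m n) → Set
DetectsAllViolations N φ =
  ∀ (w : Word _ _) → ¬ (w ⊨ φ) → ∃[ j ] NAccepts N (prefix w j)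

record TS (m n : ℕ) : Set₁ where
  field
    S   : Set
    s0  : S
    τ   : S → Subset m → S × Subset n

record Automaton (m n : ℕ) : Set₁ where
  field
    Q     : Set
    q0    : Q
    δ     : Q → Letter m n → Q → Set
    Acc   : Q → Set

module _ {m n} (A : Automaton m n) (T : TS m n) where
  open Automaton A
  open TS T

  Node : Set
  Node = S × Q

  RunEdge : Node → Letter m n → Node → Set
  RunEdge (s , q) σ (s' , q') = δ q σ q' × τ s (inputPart σ) ≡ (s' , outputPart σ)

  initNode : Node
  initNode = s0 , q0

  Reachable : Node → Node → Set
  Reachable = Star (λ x y → ∃[ σ ] RunEdge x σ y)

  record InfPath : Set where
    field
      node  : ℕ → Node
      label : ℕ → Letter m n
      start : node 0 ≡ initNode
      edge  : ∀ i → RunEdge (node i) (label i) (node (suc i))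

  UBAccepts : Set
  UBAccepts = ∀ (p : InfPath) →
    ∀ i → ∃[ j ] (i ≤ j × Acc (proj₂ (InfPath.node p j)))

-- The constructions B_{Gφ} and R = relax_FG(Gφ), from an NFA N.
-- The hypothesis h0 : q0^N ∉ F_N records that q0^N ∈ Q_φ.

module Construction {m n} (N : NFA m n) (h0 : ¬ NFA.final N (NFA.init N)) where
  open NFA N renaming (init to q0N; trans to δN; final to FN)

  data Qφ : Set where
    st  : (q : Fin k) → .(¬ FN q) → Qφ
    rej : Qφ

  q0B : Qφ
  q0B = st q0N h0

  δφ : Qφ → Letter m n → Qφ → Set
  δφ (st q _) σ (st q' _) = δN q σ q'
  δφ (st q _) σ rej = ∃[ q' ] (FN q' × δN q σ q')
  δφ rej σ (st _ _) = ⊥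
  δφ rej σ rej = ⊤

  δGφ : Qφ → Letter m n → Qφ → Set
  δGφ q σ q' = δφ q σ q'
             ⊎ (q ≡ q0B × q' ≡ q0B × ∃[ q'' ] (q'' ≢ rej × δφ q0B σ q''))

  BGφ : Automaton m n
  BGφ = record { Q = Qφ ; q0 = q0B ; δ = δGφ ; Acc = λ q → q ≢ rej }

  data QR : Set where
    rst : (q : Fin k) → .(¬ FN q) → QR

  ι : QR → Qφ
  ι (rst q p) = st q p

  q0R : QR
  q0R = rst q0N h0

  -- δ: drop transitions into rej, redirect them to q0
  δR : QR → Letter m n → QR → Set
  δR q σ q' = (δGφ (ι q) σ (ι q') × ι q' ≢ rej)
            ⊎ (q' ≡ q0R × δGφ (ι q) σ rej)

  R : Automaton m n
  R = record { Q = QR ; q0 = q0R ; δ = δR ; Acc = λ _ → ⊤ }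

  RejR : QR → Letter m n → QR → Set
  RejR q σ q' = δR q σ q' × q' ≡ q0R × δGφ (ι q) σ rej

module Submission where

-- Proof idea.  The equivalence is a structural property of the two
-- constructions.  Write B for B_{Gφ}.
--
-- (⇒) The state rej of B is absorbing and non-accepting, and every node
--     (s , rej) starts an infinite path of B's run graph.  So if some
--     (s , rej) is reachable, prefixing that path with the finite one gives
--     a path that stays in rej forever, and B rejects T.  A reachable
--     Rej-edge of R yields a reachable (s , rej): R-edges are B-edges,
--     except Rej-edges, whose B-counterparts enter rej.
-- (⇐) If no Rej-edge is reachable in R, every node (s , q) on an infinite
--     path of B's run graph has q ≠ rej and (s , q) is reachable in R's run
--     graph; by induction along the path, this invariant is preserved.

open import Defs
open import Data.Nat using (ℕ; zero; suc; _≤′_; ≤′-refl; ≤′-step)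
open import Data.Nat.Properties using (≤-refl; ≤⇒≤′)
open import Data.Product using (Σ; ∃-syntax; _,_; proj₁; proj₂)
open import Data.Sum using (_⊎_; inj₁; inj₂)
open import Data.Unit using (tt)
open import Data.Empty using (⊥; ⊥-elim)
import Data.Fin.Subset as Subset
open import Relation.Nullary using (¬_)
open import Relation.Binary.PropositionalEquality using (_≡_; refl; sym; subst)
open import Relation.Binary.Construct.Closure.ReflexiveTransitive using (Star; ε; _◅_; _◅◅_)
open import Function.Bundles using (_⇔_; mk⇔)

module RunGraphPaths {m n} (A : Automaton m n) (T : TS m n) where

  Step : Node A T → Node A T → Set
  Step x y = ∃[ σ ] RunEdge A T x σ y

  record PathFrom (x : Node A T) : Set where
    field
      node  : ℕ → Node A T
      label : ℕ → Letter m n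
      start : node 0 ≡ x
      edge  : ∀ i → RunEdge A T (node i) (label i) (node (suc i))

  open PathFrom public

  Visits : (Node A T → Set) → ∀ {x} → PathFrom x → Set
  Visits P π = ∃[ i ] P (node π i)

  prepend : ∀ {x σ y} → RunEdge A T x σ y → PathFrom y → PathFrom x
  prepend {x} {σ} e π = record { node = node′ ; label = label′ ; start = refl ; edge = edge′ }
    where
      node′ : ℕ → Node A T
      node′ zero    = x
      node′ (suc i) = node π i

      label′ : ℕ → Letter m n
      label′ zero    = σ
      label′ (suc i) = label π i

      edge′ : ∀ i → RunEdge A T (node′ i) (label′ i) (node′ (suc i))
      edge′ zero    = subst (RunEdge A T x σ) (sym (start π)) e
      edge′ (suc i) = edge π i

  prependPath : ∀ (P : Node A T → Set) {x y} → Star Step x y →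
                Σ (PathFrom y) (Visits P) → Σ (PathFrom x) (Visits P)
  prependPath P ε                 visiting = visiting
  prependPath P ((_ , e) ◅ steps) visiting with prependPath P steps visiting
  ... | π , i , p = prepend e π , suc i , p

  toInfPath : PathFrom (initNode A T) → InfPath A T
  toInfPath π = record { node = node π ; label = label π ; start = start π ; edge = edge π }

module Relaxation {m n} (N : NFA m n) (h0 : ¬ NFA.final N (NFA.init N)) (T : TS m n) where
  open Construction N h0 renaming (R to RelaxR)
  open TS T
  open RunGraphPaths BGφ T using (PathFrom; Visits; node; edge; prependPath; toInfPath)

  InRej : Node BGφ T → Set
  InRej (_ , q) = q ≡ rej

  NoReachableRejEdge : Set
  NoReachableRejEdge = ∀ s q σ s' q' →
    RunEdge RelaxR T (s , q) σ (s' , q') → RejR q σ q' →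
    ¬ Reachable RelaxR T (initNode RelaxR T) (s , q)

  RejReachable : Set
  RejReachable = ∃[ s ] Reachable BGφ T (initNode BGφ T) (s , rej)

  rej-absorbing : ∀ {q σ q'} → q ≡ rej → δGφ q σ q' → q' ≡ rej
  rej-absorbing {q' = st _ _} refl (inj₁ ())
  rej-absorbing {q' = st _ _} refl (inj₂ (() , _))
  rej-absorbing {q' = rej}    refl _ = refl

  rej-forever : ∀ {x} (π : PathFrom x) {i j} → i ≤′ j → InRej (node π i) → InRej (node π j)
  rej-forever π ≤′-refl         inRej = inRej
  rej-forever π (≤′-step i≤′j) inRej = rej-absorbing (rej-forever π i≤′j inRej) (proj₁ (edge π _))

  rejected : (π : PathFrom (initNode BGφ T)) → Visits InRej π → ¬ UBAccepts BGφ T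
  rejected π (i , inRej) accepts with accepts (toInfPath π) i
  ... | j , i≤j , notRej = notRej (rej-forever π (≤⇒≤′ i≤j) inRej)

  -- Every node (s , rej) starts an infinite path: rej loops on every letter,
  -- and T can always be fed the empty input.
  rejLoop : ∀ s → Σ (PathFrom (s , rej)) (Visits InRej)
  rejLoop s = record { node = λ i → stateAfter i , rej
                     ; label = λ i → Subset.⊥ , proj₂ (τ (stateAfter i) Subset.⊥)
                     ; start = refl
                     ; edge = λ _ → inj₁ tt , refl }
            , 0 , refl
    where
      stateAfter : ℕ → S
      stateAfter zero    = s
      stateAfter (suc i) = proj₁ (τ (stateAfter i) Subset.⊥)

  rejReachable⇒rejected : RejReachable → ¬ UBAccepts BGφ T
  rejReachable⇒rejected (s , reach) with prependPath InRej reach (rejLoop s)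
  ... | π , visitsRej = rejected π visitsRej

  embed : Node RelaxR T → Node BGφ T
  embed (s , q) = s , ι q

  edge-in-B : ∀ {x σ y} → RunEdge RelaxR T x σ y →
              RunEdge BGφ T (embed x) σ (embed y) ⊎ RunEdge BGφ T (embed x) σ (proj₁ y , rej)
  edge-in-B (inj₁ (kept , _) , move)    = inj₁ (kept , move)
  edge-in-B (inj₂ (_ , intoRej) , move) = inj₂ (intoRej , move)

  simulate : ∀ {x y} → Star (RunGraphPaths.Step RelaxR T) x y →
             Reachable BGφ T (initNode BGφ T) (embed x) →
             Reachable BGφ T (initNode BGφ T) (embed y) ⊎ RejReachable
  simulate ε reach = inj₁ reach
  simulate (_◅_ {j = y} (σ , e) steps) reach with edge-in-B e
  ... | inj₁ e′ = simulate steps (reach ◅◅ ((σ , e′) ◅ ε))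
  ... | inj₂ e′ = inj₂ (proj₁ y , reach ◅◅ ((σ , e′) ◅ ε))

  -- (⇒): the B-counterpart of a reachable Rej-edge makes a rej-node reachable.
  forward : UBAccepts BGφ T → NoReachableRejEdge
  forward accepts s q σ s' q' (_ , move) (_ , _ , intoRej) reach with simulate reach ε
  ... | inj₁ reachB = rejReachable⇒rejected (s' , reachB ◅◅ ((σ , intoRej , move) ◅ ε)) accepts
  ... | inj₂ rejR   = rejReachable⇒rejected rejR accepts

  Tracked : Node BGφ T → Set
  Tracked (s , st q p) = Reachable RelaxR T (initNode RelaxR T) (s , rst q p)
  Tracked (s , rej)    = ⊥

  -- The invariant is preserved by B-edges; entering rej would yield a reachable Rej-edge of R.
  tracked-step : NoReachableRejEdge → ∀ {x σ y} → RunEdge BGφ T x σ y → Tracked x → Tracked y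
  tracked-step _ {s , st q p} {σ} {s' , st q' p'} (kept , move) reach =
    reach ◅◅ ((σ , inj₁ (kept , λ ()) , move) ◅ ε)
  tracked-step noRej {s , st q p} {σ} {s' , rej} (intoRej , move) reach =
    ⊥-elim (noRej s (rst q p) σ s' q0R (redirected , move) (redirected , refl , intoRej) reach)
    where
      redirected : δR (rst q p) σ q0R
      redirected = inj₂ (refl , intoRej)
  tracked-step _ {s , rej} _ ()

  tracked-path : NoReachableRejEdge → (π : InfPath BGφ T) → ∀ i → Tracked (InfPath.node π i)
  tracked-path _     π zero    = subst Tracked (sym (InfPath.start π)) ε
  tracked-path noRej π (suc i) = tracked-step noRej (InfPath.edge π i) (tracked-path noRej π i)

  tracked⇒notRej : ∀ {x} → Tracked x → ¬ InRej x
  tracked⇒notRej {_ , st _ _} _ ()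
  tracked⇒notRej {_ , rej}    ()

  backward : NoReachableRejEdge → UBAccepts BGφ T
  backward noRej π i = i , ≤-refl , tracked⇒notRej (tracked-path noRej π i)

proposition2 :
    ∀ {m n} (φ : LTL (AP m n)) → SyntacticallySafe φ →
    (N : NFA m n) → AcceptsOnlyBadPrefixes N φ → DetectsAllViolations N φ →
    (h0 : ¬ NFA.final N (NFA.init N)) →
    (T : TS m n) →
    UBAccepts (Construction.BGφ N h0) T
      ⇔ (∀ s q σ s' q' →
           RunEdge (Construction.R N h0) T (s , q) σ (s' , q') →
           Construction.RejR N h0 q σ q' →
           ¬ Reachable (Construction.R N h0) T (initNode (Construction.R N h0) T) (s , q))
proposition2 _ _ N _ _ h0 T = mk⇔ forward backward
  where open Relaxation N h0 T
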